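{- Suppose that all $\sigma$-projective games of length $\omega$ are determined. Then all simple clopen games of length $\omega^2$ are determined.
   Context: A game of length $\alpha$ with payoff $A\subseteq\omega^\alpha$: players I and II alternate playing natural numbers, producing $x\in\omega^\alpha$; I wins iff $x\in A$; it is determined if one player has a winning strategy. The $\sigma$-projective sets form the smallest pointclass (of subsets of the spaces $(\omega^\omega)^k$ with the product topology of discrete $\omega$) containing the open sets and closed under complements, countable unions, and projections. Identify $\omega^{\omega\cdot n}$ with $(\omega^\omega)^n$, $\omega^{\omega^2}$ with $(\omega^\omega)^\omega$, and $A\subseteq\omega^{\omega\cdot n}$ with $\{x\in\omega^{\omega^2}:x\restriction\omega\cdot n\in A\}$. Simple clopen games of length $\omega^2$ are generated as follows: (i) for each $n\in\omega$, a game decided after $\omega\cdot n$ moves whose payoff restricted to sequences of length $\omega\cdot n$ is clopen is simple clopen; (ii) if $n\in\omega$ and $G_i$ ($i\in\omega$) are simple clopen, then the game in which I and II alternate for $\omega\cdot n$ moves, then Player I plays some $i\in\omega$, and then play continues according to the rules of $G_i$ (keeping the first $\omega\cdot n$ moves, but not $i$) is simple clopen; (iii) the same as (ii) with Player II choosing $i$. -}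

module Defs where

open import Data.Nat using (ℕ; zero; suc; _<_; _∸_; _+_)
open import Data.Fin using (Fin; toℕ)
open import Data.List using (List; []; _∷_; reverse; length)
open import Data.Product using (Σ; _×_; _,_)
open import Data.Sum using (_⊎_)
open import Data.Empty using (⊥)
open import Relation.Nullary using (¬_; yes; no)
open import Data.Bool using (Bool; true; false; not; if_then_else_)
open import Relation.Binary.PropositionalEquality using (_≡_)
open import Data.Vec.Functional using (insertAt)
open import Function.Bundles using (_⇔_)

Baire : Set
Baire = ℕ → ℕ

Pt : ℕ → Set
Pt k = Fin k → Baire

IsOpen : (k : ℕ) → (Pt k → Set) → Set
IsOpen k A = ∀ v → A v → Σ ℕ λ n →
  ∀ w → (∀ (j : Fin k) (m : ℕ) → m < n → w j m ≡ v j m) → A w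

IsClopen : (k : ℕ) → (Pt k → Set) → Set
IsClopen k A = IsOpen k A × IsOpen k (λ v → ¬ A v)

-- Sets are predicates, taken up to
-- extensional equality.

data SigmaProj : (k : ℕ) → (Pt k → Set) → Set₁ where
  open′  : ∀ {k} {A : Pt k → Set} → IsOpen k A → SigmaProj k A
  compl  : ∀ {k} {A : Pt k → Set} → SigmaProj k A → SigmaProj k (λ v → ¬ A v)
  union  : ∀ {k} {B : ℕ → Pt k → Set} → (∀ i → SigmaProj k (B i)) →
           SigmaProj k (λ v → Σ ℕ λ i → B i v)
  proj   : ∀ {k} {B : Pt (suc k) → Set} (j : Fin (suc k)) → SigmaProj (suc k) B →
           SigmaProj k (λ v → Σ Baire λ y → B (insertAt v j y))
  ext    : ∀ {k} {A B : Pt k → Set} → SigmaProj k A → (∀ v → A v ⇔ B v) →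
           SigmaProj k B

-- Games of length ω on ω.  A strategy sees the finite history
-- (most recent move first); I moves at even positions, II at odd ones.

isEven : ℕ → Bool
isEven zero = true
isEven (suc n) = not (isEven n)

Strat : Set
Strat = List ℕ → ℕ

history : Strat → Strat → ℕ → List ℕ
history σ τ zero = []
history σ τ (suc n) =
  (if isEven n then σ (history σ τ n) else τ (history σ τ n)) ∷ history σ τ n

play : Strat → Strat → Baire
play σ τ n = (if isEven n then σ (history σ τ n) else τ (history σ τ n))

WinsI : (Baire → Set) → Set
WinsI A = Σ Strat λ σ → ∀ τ → A (play σ τ)

WinsII : (Baire → Set) → Set
WinsII A = Σ Strat λ τ → ∀ σ → ¬ A (play σ τ)

Determined : (Baire → Set) → Set
Determined A = WinsI A ⊎ WinsII A

SigmaProjGamesDetermined : Set₁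
SigmaProjGamesDetermined =
  (A : Pt 1 → Set) → SigmaProj 1 A → Determined (λ x → A (λ _ → x))

data SimpleClopen : Set₁ where
  -- (i) decided after ω·n moves with clopen payoff on (ω^ω)^n
  base     : (n : ℕ) (A : Pt n → Set) → IsClopen n A → SimpleClopen
  -- (ii) after ω·n moves, I chooses i, continue with G i
  choiceI  : (n : ℕ) → (ℕ → SimpleClopen) → SimpleClopen
  -- (iii) after ω·n moves, II chooses i, continue with G i
  choiceII : (n : ℕ) → (ℕ → SimpleClopen) → SimpleClopen

-- Events of a play of length < ω²: a completed ω-block of moves, or a
-- choice of an index i (which is not part of the resulting real
-- sequence, but is visible to both players).
data Event : Set where
  block  : Baire → Event
  choice : ℕ → Event

-- A strategy in a long game: a move function (given past events, most
-- recent first, and the current finite partial block, most recent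
-- first) and a choice function (given the past events).
record LStrat : Set where
  field
    move : List Event → List ℕ → ℕ
    pick : List Event → ℕ
open LStrat public

nBlocks : List Event → ℕ
nBlocks [] = 0
nBlocks (block _ ∷ e) = suc (nBlocks e)
nBlocks (choice _ ∷ e) = nBlocks e

nextBlock : LStrat → LStrat → List Event → Baire
nextBlock σ τ e = play (move σ e) (move τ e)

runBlocks : LStrat → LStrat → ℕ → List Event → List Event
runBlocks σ τ zero e = e
runBlocks σ τ (suc k) e = runBlocks σ τ k (block (nextBlock σ τ e) ∷ e)

blocksOf : List Event → List Baire
blocksOf [] = []
blocksOf (block x ∷ e) = x ∷ blocksOf e
blocksOf (choice _ ∷ e) = blocksOf e

lookupD : List Baire → ℕ → Baire
lookupD [] _ = λ _ → 0
lookupD (x ∷ xs) zero = x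
lookupD (x ∷ xs) (suc m) = lookupD xs m

firstBlocks : (n : ℕ) → List Event → Pt n
firstBlocks n e j = lookupD (reverse (blocksOf e)) (toℕ j)

-- Blocks are played until the number
-- of completed blocks reaches the stage ω·n prescribed by G.
WinsPlay : SimpleClopen → LStrat → LStrat → List Event → Set
WinsPlay (base n A _) σ τ e =
  A (firstBlocks n (runBlocks σ τ (n ∸ nBlocks e) e))
WinsPlay (choiceI n G) σ τ e =
  let e′ = runBlocks σ τ (n ∸ nBlocks e) e
      i  = pick σ e′
  in WinsPlay (G i) σ τ (choice i ∷ e′)
WinsPlay (choiceII n G) σ τ e =
  let e′ = runBlocks σ τ (n ∸ nBlocks e) e
      i  = pick τ e′
  in WinsPlay (G i) σ τ (choice i ∷ e′)

DeterminedSC : SimpleClopen → Set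
DeterminedSC G =
  (Σ LStrat λ σ → ∀ τ → WinsPlay G σ τ [])
  ⊎ (Σ LStrat λ τ → ∀ σ → ¬ WinsPlay G σ τ [])

{-# OPTIONS --safe #-}
module Submission where

-- Determinacy is proved for all positions of the game at once, by recursion on the game
-- and on the number of ω-blocks still due before its next stage.  At a stage the chooser
-- wins iff some option is won, and otherwise the opponent wins every option.  When a block
-- is due, it is a game of length ω whose payoff is the set of blocks leading to a position
-- won by I.  That payoff is σ-projective: the positions won by I, parametrised
-- continuously by their completed blocks, arise from the clopen payoffs by countable
-- unions (choices of I), countable intersections (choices of II) and, for each block, an
-- ∃∀ over reals coding strategies, on which the resulting block depends continuously.
-- Determinacy of games with a constant payoff yields excluded middle, which supplies the
-- classical steps: decoding strategies and splicing winning strategies together.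

open import Defs
open import Data.Bool using (true; false; if_then_else_)
open import Data.Empty using (⊥-elim)
open import Data.Fin using (Fin; toℕ) renaming (zero to fzero; suc to fsuc)
open import Data.List using (List; []; _∷_; _++_; length)
open import Data.List.Properties using (∷-injectiveˡ; ∷-injectiveʳ; ++-assoc; length-++)
open import Data.List.Relation.Binary.Pointwise as Pointwise using (Pointwise; []; _∷_; reverse⁺)
open import Data.Nat using (ℕ; zero; suc; _<_; _≤_; _∸_; _+_; _⊔_; z≤n; s≤s; pred)
open import Data.Nat.Properties
open import Data.Product using (Σ; _×_; _,_; proj₁; proj₂)
open import Data.Sum using (_⊎_; inj₁; inj₂; [_,_]′)
open import Data.Vec.Functional using (insertAt; head; tail)
open import Function using (_∘_; id)
open import Function.Bundles using (_⇔_; mk⇔; Equivalence)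
open import Relation.Binary.Definitions using (tri<; tri≈; tri>)
open import Relation.Binary.PropositionalEquality
open import Relation.Nullary using (¬_; Dec; yes; no; does)
open import Relation.Nullary.Decidable using (dec-true; dec-false)

-- Agreement of points, continuity and σ-projective sets

_≡[<_]_ : Baire → ℕ → Baire → Set
x ≡[< n ] y = ∀ m → m < n → x m ≡ y m

_≈[<_]_ : ∀ {k} → Pt k → ℕ → Pt k → Set
u ≈[< n ] v = ∀ j → u j ≡[< n ] v j

_≋_ : ∀ {k} → Pt k → Pt k → Set
u ≋ v = ∀ j → u j ≗ v j

≈[<]-mono : ∀ {k M N} {u v : Pt k} → M ≤ N → u ≈[< N ] v → u ≈[< M ] v
≈[<]-mono M≤N u≈v j m m<M = u≈v j m (<-≤-trans m<M M≤N)

Continuous : ∀ {m k} → (Pt m → Pt k) → Set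
Continuous f = ∀ v n → Σ ℕ λ N → ∀ w → w ≈[< N ] v → f w ≈[< n ] f v

insertAt-≈[<] : ∀ {k n} {u v : Pt k} (j : Fin (suc k)) {x y : Baire} →
  u ≈[< n ] v → x ≡[< n ] y → insertAt u j x ≈[< n ] insertAt v j y
insertAt-≈[<] fzero u≈v x≡y fzero = x≡y
insertAt-≈[<] fzero u≈v x≡y (fsuc i) = u≈v i
insertAt-≈[<] {suc k} (fsuc j) u≈v x≡y fzero = u≈v fzero
insertAt-≈[<] {suc k} (fsuc j) u≈v x≡y (fsuc i) = insertAt-≈[<] j (u≈v ∘ fsuc) x≡y i

insertAt-≋ : ∀ {k} {u v : Pt k} (j : Fin (suc k)) (x : Baire) →
  u ≋ v → insertAt u j x ≋ insertAt v j x
insertAt-≋ j x u≋v i m =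
  insertAt-≈[<] {n = suc m} j (λ i m′ _ → u≋v i m′) (λ _ _ → refl) i m ≤-refl

sigmaProj-resp-≋ : ∀ {k} {B : Pt k → Set} → SigmaProj k B → ∀ {u v} → u ≋ v → B u → B v
sigmaProj-resp-≋ (open′ o) {u} u≋v b = proj₂ (o u b) _ (λ j m _ → sym (u≋v j m))
sigmaProj-resp-≋ (compl s) u≋v ¬b b′ = ¬b (sigmaProj-resp-≋ s (λ j m → sym (u≋v j m)) b′)
sigmaProj-resp-≋ (union s) u≋v (i , b) = i , sigmaProj-resp-≋ (s i) u≋v b
sigmaProj-resp-≋ (proj j s) u≋v (y , b) = y , sigmaProj-resp-≋ s (insertAt-≋ j y u≋v) b
sigmaProj-resp-≋ (ext s A⇔B) {u} {v} u≋v b =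
  Equivalence.to (A⇔B v) (sigmaProj-resp-≋ s u≋v (Equivalence.from (A⇔B u) b))

sigmaProj-preimage : ∀ {k} {B : Pt k → Set} → SigmaProj k B →
  ∀ {m} {f : Pt m → Pt k} → Continuous f → SigmaProj m (B ∘ f)
sigmaProj-preimage (open′ o) {f = f} f-cont = open′ λ v b →
  let (n , nbhd) = o (f v) b
      (N , f-nbhd) = f-cont v n
  in N , λ w w≈v → nbhd (f w) (f-nbhd w w≈v)
sigmaProj-preimage (compl s) f-cont = compl (sigmaProj-preimage s f-cont)
sigmaProj-preimage (union s) f-cont = union (λ i → sigmaProj-preimage (s i) f-cont)
sigmaProj-preimage (ext s A⇔B) {f = f} f-cont = ext (sigmaProj-preimage s f-cont) (A⇔B ∘ f)
sigmaProj-preimage {k} (proj j s) {m} {f} f-cont = proj fzero (sigmaProj-preimage s g-cont)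
  where
  g : Pt (suc m) → Pt (suc k)
  g u = insertAt (f (tail u)) j (head u)
  g-cont : Continuous g
  g-cont u n = N ⊔ n , λ w w≈u →
    insertAt-≈[<] j (f-nbhd (tail w) (≈[<]-mono (m≤m⊔n N n) w≈u ∘ fsuc))
                    (≈[<]-mono (m≤n⊔m N n) w≈u fzero)
    where
    N = proj₁ (f-cont (tail u) n)
    f-nbhd = proj₂ (f-cont (tail u) n)

-- Coding strategies by reals

triangle : ℕ → ℕ
triangle zero = zero
triangle (suc n) = suc n + triangle n

triangle-mono-≤ : ∀ {m n} → m ≤ n → triangle m ≤ triangle n
triangle-mono-≤ {zero} _ = z≤n
triangle-mono-≤ {suc m} {suc n} (s≤s m≤n) = +-mono-≤ (s≤s m≤n) (triangle-mono-≤ m≤n)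

⟪_,_⟫ : ℕ → ℕ → ℕ
⟪ a , b ⟫ = triangle (a + b) + a

⟪⟫-<-on-diagonals : ∀ a b c d → a + b < c + d → ⟪ a , b ⟫ < ⟪ c , d ⟫
⟪⟫-<-on-diagonals a b c d a+b<c+d = begin-strict
  triangle (a + b) + a           ≤⟨ +-monoʳ-≤ (triangle (a + b)) (m≤m+n a b) ⟩
  triangle (a + b) + (a + b)     ≡⟨ +-comm (triangle (a + b)) (a + b) ⟩
  a + b + triangle (a + b)       <⟨ n<1+n _ ⟩
  triangle (suc (a + b))         ≤⟨ triangle-mono-≤ a+b<c+d ⟩
  triangle (c + d)               ≤⟨ m≤m+n (triangle (c + d)) c ⟩
  triangle (c + d) + c           ∎
  where open ≤-Reasoning

⟪⟫-injective : ∀ a b c d → ⟪ a , b ⟫ ≡ ⟪ c , d ⟫ → a ≡ c × b ≡ d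
⟪⟫-injective a b c d eq with <-cmp (a + b) (c + d)
... | tri< a+b<c+d _ _ = ⊥-elim (<-irrefl eq (⟪⟫-<-on-diagonals a b c d a+b<c+d))
... | tri> _ _ c+d<a+b = ⊥-elim (<-irrefl (sym eq) (⟪⟫-<-on-diagonals c d a b c+d<a+b))
... | tri≈ _ a+b≡c+d _ = a≡c , +-cancelˡ-≡ c b d (trans (cong (_+ b) (sym a≡c)) a+b≡c+d)
  where
  a≡c : a ≡ c
  a≡c = +-cancelˡ-≡ (triangle (c + d)) a c
          (trans (cong (λ s → triangle s + a) (sym a+b≡c+d)) eq)

encodeList : List ℕ → ℕ
encodeList [] = 0
encodeList (x ∷ xs) = suc ⟪ x , encodeList xs ⟫

encodeList-injective : ∀ xs ys → encodeList xs ≡ encodeList ys → xs ≡ ys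
encodeList-injective [] [] _ = refl
encodeList-injective (x ∷ xs) (y ∷ ys) eq =
  let (x≡y , codes≡) = ⟪⟫-injective x (encodeList xs) y (encodeList ys) (suc-injective eq)
  in cong₂ _∷_ x≡y (encodeList-injective xs ys codes≡)

asStrategy : Baire → Strat
asStrategy r = r ∘ encodeList

play-step : ∀ n {σ τ σ′ τ′} → history σ′ τ′ n ≡ history σ τ n →
  σ′ (history σ τ n) ≡ σ (history σ τ n) → τ′ (history σ τ n) ≡ τ (history σ τ n) →
  play σ′ τ′ n ≡ play σ τ n
play-step n h≡ σ≡ τ≡ rewrite h≡ with isEven n
... | true = σ≡
... | false = τ≡

history-cong : ∀ {σ τ σ′ τ′} → σ′ ≗ σ → τ′ ≗ τ → history σ′ τ′ ≗ history σ τ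
history-cong σ≗ τ≗ zero = refl
history-cong σ≗ τ≗ (suc n) =
  cong₂ _∷_ (play-step n (history-cong σ≗ τ≗ n) (σ≗ _) (τ≗ _)) (history-cong σ≗ τ≗ n)

play-cong : ∀ {σ τ σ′ τ′} → σ′ ≗ σ → τ′ ≗ τ → play σ′ τ′ ≗ play σ τ
play-cong σ≗ τ≗ n = ∷-injectiveˡ (history-cong σ≗ τ≗ (suc n))

history-continuous : ∀ r q n → Σ ℕ λ N → ∀ {r′ q′} → r′ ≡[< N ] r → q′ ≡[< N ] q →
  ∀ m → m ≤ n →
  history (asStrategy r′) (asStrategy q′) m ≡ history (asStrategy r) (asStrategy q) m
history-continuous r q zero = 0 , λ { _ _ zero z≤n → refl }
history-continuous r q (suc n) = N , agree
  where
  N₀ = proj₁ (history-continuous r q n)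
  agree₀ = proj₂ (history-continuous r q n)
  hₙ = history (asStrategy r) (asStrategy q) n
  N = N₀ ⊔ suc (encodeList hₙ)
  agree : ∀ {r′ q′} → r′ ≡[< N ] r → q′ ≡[< N ] q → ∀ m → m ≤ suc n →
    history (asStrategy r′) (asStrategy q′) m ≡ history (asStrategy r) (asStrategy q) m
  agree r′≡r q′≡q m m≤1+n with m≤n⇒m<n∨m≡n m≤1+n
  ... | inj₁ (s≤s m≤n) = agree₀ (λ i i< → r′≡r i (<-≤-trans i< (m≤m⊔n N₀ _)))
                                (λ i i< → q′≡q i (<-≤-trans i< (m≤m⊔n N₀ _))) m m≤n
  ... | inj₂ refl = cong₂ _∷_ (play-step n hₙ≡ (r′≡r _ code<) (q′≡q _ code<)) hₙ≡
    where
    hₙ≡ = agree₀ (λ i i< → r′≡r i (<-≤-trans i< (m≤m⊔n N₀ _)))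
                 (λ i i< → q′≡q i (<-≤-trans i< (m≤m⊔n N₀ _))) n ≤-refl
    code< : encodeList hₙ < N
    code< = m≤n⊔m N₀ _

play-continuous : ∀ r q n → Σ ℕ λ N → ∀ {r′ q′} → r′ ≡[< N ] r → q′ ≡[< N ] q →
  play (asStrategy r′) (asStrategy q′) ≡[< n ] play (asStrategy r) (asStrategy q)
play-continuous r q n =
  let (N , agree) = history-continuous r q n
  in N , λ r′≡r q′≡q m m<n → ∷-injectiveˡ (agree r′≡r q′≡q (suc m) m<n)

-- Positions and strategies in simple clopen games

stage : SimpleClopen → ℕ
stage (base n _ _) = n
stage (choiceI n _) = n
stage (choiceII n _) = n

WinsAtStage : SimpleClopen → LStrat → LStrat → List Event → Set
WinsAtStage (base n A _) σ τ e = A (firstBlocks n e)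
WinsAtStage (choiceI n Gs) σ τ e = WinsPlay (Gs (pick σ e)) σ τ (choice (pick σ e) ∷ e)
WinsAtStage (choiceII n Gs) σ τ e = WinsPlay (Gs (pick τ e)) σ τ (choice (pick τ e) ∷ e)

WinsPlay-unfold : ∀ G {σ τ e} →
  WinsPlay G σ τ e ≡ WinsAtStage G σ τ (runBlocks σ τ (stage G ∸ nBlocks e) e)
WinsPlay-unfold (base _ _ _) = refl
WinsPlay-unfold (choiceI _ _) = refl
WinsPlay-unfold (choiceII _ _) = refl

m∸n≡1+r⇒m∸[1+n]≡r : ∀ m n {r} → m ∸ n ≡ suc r → m ∸ suc n ≡ r
m∸n≡1+r⇒m∸[1+n]≡r m n eq = trans (sym (pred[m∸n]≡m∸[1+n] m n)) (cong pred eq)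

WinsPlay-block : ∀ G {σ τ e r s t} → stage G ∸ nBlocks e ≡ suc r → move σ e ≡ s → move τ e ≡ t →
  WinsPlay G σ τ e ≡ WinsPlay G σ τ (block (play s t) ∷ e)
WinsPlay-block G {σ} {τ} {e} {r} eq refl refl = begin
  WinsPlay G σ τ e
    ≡⟨ WinsPlay-unfold G ⟩
  WinsAtStage G σ τ (runBlocks σ τ (stage G ∸ nBlocks e) e)
    ≡⟨ cong (λ k → WinsAtStage G σ τ (runBlocks σ τ k e)) eq ⟩
  WinsAtStage G σ τ (runBlocks σ τ r (block (nextBlock σ τ e) ∷ e))
    ≡⟨ cong (λ k → WinsAtStage G σ τ (runBlocks σ τ k (block (nextBlock σ τ e) ∷ e)))
            (sym (m∸n≡1+r⇒m∸[1+n]≡r (stage G) (nBlocks e) eq)) ⟩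
  WinsAtStage G σ τ (runBlocks σ τ (stage G ∸ suc (nBlocks e)) (block (nextBlock σ τ e) ∷ e))
    ≡⟨ sym (WinsPlay-unfold G) ⟩
  WinsPlay G σ τ (block (nextBlock σ τ e) ∷ e) ∎
  where open ≡-Reasoning

WinsPlay-atStage : ∀ G {σ τ e} → stage G ∸ nBlocks e ≡ 0 →
  WinsPlay G σ τ e ≡ WinsAtStage G σ τ e
WinsPlay-atStage G {σ} {τ} {e} eq =
  trans (WinsPlay-unfold G) (cong (λ k → WinsAtStage G σ τ (runBlocks σ τ k e)) eq)

WinsPlay-choiceI : ∀ {n Gs σ τ e i} → n ∸ nBlocks e ≡ 0 → pick σ e ≡ i →
  WinsPlay (choiceI n Gs) σ τ e ≡ WinsPlay (Gs i) σ τ (choice i ∷ e)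
WinsPlay-choiceI {n} {Gs} eq refl = WinsPlay-atStage (choiceI n Gs) eq

WinsPlay-choiceII : ∀ {n Gs σ τ e i} → n ∸ nBlocks e ≡ 0 → pick τ e ≡ i →
  WinsPlay (choiceII n Gs) σ τ e ≡ WinsPlay (Gs i) σ τ (choice i ∷ e)
WinsPlay-choiceII {n} {Gs} eq refl = WinsPlay-atStage (choiceII n Gs) eq

_extends_ : List Event → List Event → Set
e′ extends e = Σ (List Event) λ d → e′ ≡ d ++ e

extends-refl : ∀ {e} → e extends e
extends-refl = [] , refl

∷-extends : ∀ {a e} → (a ∷ e) extends e
∷-extends {a} = a ∷ [] , refl

extends-trans : ∀ {e″ e′ e} → e″ extends e′ → e′ extends e → e″ extends e
extends-trans {e = e} (d′ , refl) (d , refl) = d′ ++ d , sym (++-assoc d′ d e)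

runBlocks-extends : ∀ {σ τ} k e → runBlocks σ τ k e extends e
runBlocks-extends zero e = extends-refl
runBlocks-extends (suc k) e = extends-trans (runBlocks-extends k (block _ ∷ e)) ∷-extends

extends-∷-unique : ∀ {a a′ e e′} → e′ extends (a ∷ e) → e′ extends (a′ ∷ e) → a ≡ a′
extends-∷-unique {a} {a′} {e} (d , refl) (d′ , eq) = ∷-injectiveˡ (++-cancel d d′ |d|≡|d′| eq)
  where
  ++-cancel : ∀ {A : Set} (xs ys : List A) {zs ws} →
    length xs ≡ length ys → xs ++ zs ≡ ys ++ ws → zs ≡ ws
  ++-cancel [] [] _ eq = eq
  ++-cancel (x ∷ xs) (y ∷ ys) len eq = ++-cancel xs ys (suc-injective len) (∷-injectiveʳ eq)
  |d|≡|d′| : length d ≡ length d′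
  |d|≡|d′| = +-cancelʳ-≡ (length (a ∷ e)) (length d) (length d′)
    (trans (sym (length-++ d)) (trans (cong length eq) (length-++ d′)))

¬extends-∷-self : ∀ {a e} → ¬ e extends (a ∷ e)
¬extends-∷-self {a} {e} (d , eq) = <-irrefl refl (begin-strict
  length e              <⟨ m≤n+m (suc (length e)) (length d) ⟩
  length d + length (a ∷ e) ≡⟨ sym (length-++ d) ⟩
  length (d ++ a ∷ e)   ≡⟨ cong length (sym eq) ⟩
  length e              ∎)
  where open ≤-Reasoning

_≃[_]_ : LStrat → List Event → LStrat → Set
σ ≃[ e ] σ′ = ∀ {e′} → e′ extends e → move σ e′ ≡ move σ′ e′ × pick σ e′ ≡ pick σ′ e′

≃-refl : ∀ {σ e} → σ ≃[ e ] σ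
≃-refl _ = refl , refl

≃-extend : ∀ {σ σ′ e e′} → e′ extends e → σ ≃[ e ] σ′ → σ ≃[ e′ ] σ′
≃-extend e′⊒e σ≃ e″⊒e′ = σ≃ (extends-trans e″⊒e′ e′⊒e)

runBlocks-cong : ∀ k {σ σ′ τ τ′ e} → σ ≃[ e ] σ′ → τ ≃[ e ] τ′ →
  runBlocks σ τ k e ≡ runBlocks σ′ τ′ k e
runBlocks-cong zero _ _ = refl
runBlocks-cong (suc k) {σ} {σ′} {τ} {τ′} {e} σ≃ τ≃ =
  trans (cong (λ x → runBlocks σ τ k (block x ∷ e)) next≡)
        (runBlocks-cong k (≃-extend ∷-extends σ≃) (≃-extend ∷-extends τ≃))
  where
  next≡ : nextBlock σ τ e ≡ nextBlock σ′ τ′ e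
  next≡ = cong₂ play (proj₁ (σ≃ extends-refl)) (proj₁ (τ≃ extends-refl))

WinsPlay-cong : ∀ G {σ σ′ τ τ′ e} → σ ≃[ e ] σ′ → τ ≃[ e ] τ′ →
  WinsPlay G σ τ e ≡ WinsPlay G σ′ τ′ e
WinsAtStage-cong : ∀ G {σ σ′ τ τ′ e} → σ ≃[ e ] σ′ → τ ≃[ e ] τ′ →
  WinsAtStage G σ τ e ≡ WinsAtStage G σ′ τ′ e

WinsPlay-cong G {σ} {σ′} {τ} {τ′} {e} σ≃ τ≃ = begin
  WinsPlay G σ τ e
    ≡⟨ WinsPlay-unfold G ⟩
  WinsAtStage G σ τ (runBlocks σ τ k e)
    ≡⟨ WinsAtStage-cong G (≃-extend played σ≃) (≃-extend played τ≃) ⟩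
  WinsAtStage G σ′ τ′ (runBlocks σ τ k e)
    ≡⟨ cong (WinsAtStage G σ′ τ′) (runBlocks-cong k σ≃ τ≃) ⟩
  WinsAtStage G σ′ τ′ (runBlocks σ′ τ′ k e)
    ≡⟨ sym (WinsPlay-unfold G) ⟩
  WinsPlay G σ′ τ′ e ∎
  where
  open ≡-Reasoning
  k = stage G ∸ nBlocks e
  played = runBlocks-extends k e

WinsAtStage-cong (base _ _ _) _ _ = refl
WinsAtStage-cong (choiceI _ Gs) {σ} {e = e} σ≃ τ≃
  with pick σ e | proj₂ (σ≃ extends-refl)
... | _ | refl = WinsPlay-cong (Gs _) (≃-extend ∷-extends σ≃) (≃-extend ∷-extends τ≃)
WinsAtStage-cong (choiceII _ Gs) {τ = τ} {e = e} σ≃ τ≃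
  with pick τ e | proj₂ (τ≃ extends-refl)
... | _ | refl = WinsPlay-cong (Gs _) (≃-extend ∷-extends σ≃) (≃-extend ∷-extends τ≃)

IWinsFrom : SimpleClopen → List Event → Set
IWinsFrom G e = Σ LStrat λ σ → ∀ τ → WinsPlay G σ τ e

IIWinsFrom : SimpleClopen → List Event → Set
IIWinsFrom G e = Σ LStrat λ τ → ∀ σ → ¬ WinsPlay G σ τ e

idle : LStrat
idle = record { move = λ _ _ → 0 ; pick = λ _ → 0 }

module _ {n A} (A-clopen : IsClopen n A) (e : List Event) (eq : n ∸ nBlocks e ≡ 0) where

  IWinsFrom-base⇔ : A (firstBlocks n e) ⇔ IWinsFrom (base n A A-clopen) e
  IWinsFrom-base⇔ = mk⇔
    (λ a → idle , λ τ → subst id (sym (WinsPlay-atStage (base n A A-clopen) {e = e} eq)) a)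
    (λ (σ , win) → subst id (WinsPlay-atStage (base n A A-clopen) {e = e} eq) (win idle))

  IIWinsFrom-base : ¬ A (firstBlocks n e) → IIWinsFrom (base n A A-clopen) e
  IIWinsFrom-base ¬a = idle , λ σ →
    ¬a ∘ subst id (WinsPlay-atStage (base n A A-clopen) {e = e} eq)

-- Continuously parametrised positions

ContinuousPositions : ∀ {k} → (Pt k → List Event) → ℕ → Set
ContinuousPositions E c =
  (∀ v → nBlocks (E v) ≡ c) ×
  (∀ v N → Σ ℕ λ M → ∀ w → w ≈[< M ] v →
     Pointwise (_≡[< N ]_) (blocksOf (E w)) (blocksOf (E v)))

lookupD-cong : ∀ {N xs ys} → Pointwise (_≡[< N ]_) xs ys →
  ∀ t → lookupD xs t ≡[< N ] lookupD ys t
lookupD-cong [] t _ _ = refl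
lookupD-cong (x≡y ∷ _) zero = x≡y
lookupD-cong (_ ∷ xs≡ys) (suc t) = lookupD-cong xs≡ys t

firstBlocks-continuous : ∀ {k} (E : Pt k → List Event) {c} → ContinuousPositions E c →
  ∀ n → Continuous (firstBlocks n ∘ E)
firstBlocks-continuous E (_ , blocks-cont) n v N =
  let (M , blocks≡) = blocks-cont v N
  in M , λ w w≈v j → lookupD-cong (reverse⁺ (blocks≡ w w≈v)) (toℕ j)

pushBlock : ∀ {k} → (Pt k → List Event) → Pt (suc k) → List Event
pushBlock E u = block (head u) ∷ E (tail u)

pushBlock-continuous : ∀ {k} (E : Pt k → List Event) {c} → ContinuousPositions E c →
  ContinuousPositions (pushBlock E) (suc c)
pushBlock-continuous E (blocks≡c , blocks-cont) = (cong suc ∘ blocks≡c ∘ tail) , λ u N →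
  let (M , blocks≡) = blocks-cont (tail u) N
  in M ⊔ N , λ w w≈u →
       ≈[<]-mono (m≤n⊔m M N) w≈u fzero
       ∷ blocks≡ (tail w) (≈[<]-mono (m≤m⊔n M N) w≈u ∘ fsuc)

const-continuous : ∀ e → ContinuousPositions {0} (λ _ → e) (nBlocks e)
const-continuous e = (λ _ → refl) , λ _ _ → 0 , λ _ _ → Pointwise.refl (λ _ _ → refl)

-- Coordinates 1 and 0 code the strategies of I and II for the next block, which replaces them.
playCoordinate : ∀ {k} → Pt (suc (suc k)) → Pt (suc k)
playCoordinate u =
  insertAt (tail (tail u)) fzero (play (asStrategy (u (fsuc fzero))) (asStrategy (u fzero)))

playCoordinate-continuous : ∀ {k} → Continuous (playCoordinate {k})
playCoordinate-continuous u n = N ⊔ n , λ w w≈u →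
  insertAt-≈[<] fzero (≈[<]-mono (m≤n⊔m N n) w≈u ∘ fsuc ∘ fsuc)
    (play≡ (≈[<]-mono (m≤m⊔n N n) w≈u (fsuc fzero)) (≈[<]-mono (m≤m⊔n N n) w≈u fzero))
  where
  N = proj₁ (play-continuous (u (fsuc fzero)) (u fzero) n)
  play≡ = proj₂ (play-continuous (u (fsuc fzero)) (u fzero) n)

-- Excluded middle and strategy surgery

-- A game whose payoff is a constant proposition P is open, so its determinacy decides P.
excludedMiddle : SigmaProjGamesDetermined → (P : Set) → Dec P
excludedMiddle det P with det (λ _ → P) (open′ λ _ p → 0 , λ _ _ → p)
... | inj₁ (_ , I-wins) = yes (I-wins (λ _ → 0))
... | inj₂ (_ , II-wins) = no (II-wins (λ _ → 0))

module Classical (lem : (P : Set) → Dec P) where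

  select : ∀ {A : Set} → A → (P : A → Set) → A
  select a P with lem (Σ _ P)
  ... | yes (x , _) = x
  ... | no _ = a

  select-spec : ∀ {A : Set} (a : A) (P : A → Set) → Σ A P → P (select a P)
  select-spec a P (x , px) with lem (Σ _ P)
  ... | yes (_ , py) = py
  ... | no ∄ = ⊥-elim (∄ (x , px))

  ¬¬-elim : ∀ {P : Set} → ¬ ¬ P → P
  ¬¬-elim {P} ¬¬p with lem P
  ... | yes p = p
  ... | no ¬p = ⊥-elim (¬¬p ¬p)

  code : Strat → Baire
  code σ n = σ (select [] (λ xs → encodeList xs ≡ n))

  asStrategy-code : ∀ σ → asStrategy (code σ) ≗ σ
  asStrategy-code σ xs =
    cong σ (encodeList-injective _ xs
              (select-spec [] (λ ys → encodeList ys ≡ encodeList xs) (xs , refl)))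

  eventAfter : List Event → List Event → Event
  eventAfter e e′ = select (choice 0) (λ a → e′ extends (a ∷ e))

  eventAfter-spec : ∀ {a e e′} → e′ extends (a ∷ e) → eventAfter e e′ ≡ a
  eventAfter-spec {e = e} {e′} e′⊒a∷e =
    extends-∷-unique (select-spec (choice 0) (λ a → e′ extends (a ∷ e)) (_ , e′⊒a∷e)) e′⊒a∷e

  splice : List Event → Strat → ℕ → (Event → LStrat) → LStrat
  splice e s i F = record
    { move = λ e′ → if does (lem (e′ ≡ e)) then s else move (F (eventAfter e e′)) e′
    ; pick = λ e′ → if does (lem (e′ ≡ e)) then i else pick (F (eventAfter e e′)) e′
    }

  move-splice : ∀ e s i F → move (splice e s i F) e ≡ s
  move-splice e _ _ _ rewrite dec-true (lem (e ≡ e)) refl = refl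

  pick-splice : ∀ e s i F → pick (splice e s i F) e ≡ i
  pick-splice e _ _ _ rewrite dec-true (lem (e ≡ e)) refl = refl

  splice-≃ : ∀ e s i F a → splice e s i F ≃[ a ∷ e ] F a
  splice-≃ e _ _ _ a {e′} e′⊒a∷e
    rewrite dec-false (lem (e′ ≡ e)) (λ { refl → ¬extends-∷-self e′⊒a∷e })
          | eventAfter-spec e′⊒a∷e
    = refl , refl

  winnerI : SimpleClopen → List Event → LStrat
  winnerI G e = select idle (λ σ → ∀ τ → WinsPlay G σ τ e)

  winnerII : SimpleClopen → List Event → LStrat
  winnerII G e = select idle (λ τ → ∀ σ → ¬ WinsPlay G σ τ e)

  followI : (Event → SimpleClopen) → List Event → Strat → ℕ → LStrat
  followI next e s i = splice e s i (λ a → winnerI (next a) (a ∷ e))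

  followII : (Event → SimpleClopen) → List Event → Strat → ℕ → LStrat
  followII next e t i = splice e t i (λ a → winnerII (next a) (a ∷ e))

  followI-move : ∀ next e s i → move (followI next e s i) e ≡ s
  followI-move next e s i = move-splice e s i (λ a → winnerI (next a) (a ∷ e))

  followI-pick : ∀ next e s i → pick (followI next e s i) e ≡ i
  followI-pick next e s i = pick-splice e s i (λ a → winnerI (next a) (a ∷ e))

  followII-move : ∀ next e t i → move (followII next e t i) e ≡ t
  followII-move next e t i = move-splice e t i (λ a → winnerII (next a) (a ∷ e))

  followII-pick : ∀ next e t i → pick (followII next e t i) e ≡ i
  followII-pick next e t i = pick-splice e t i (λ a → winnerII (next a) (a ∷ e))

  followI-wins : ∀ next e s i a → IWinsFrom (next a) (a ∷ e) →
    ∀ τ → WinsPlay (next a) (followI next e s i) τ (a ∷ e)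
  followI-wins next e s i a win τ =
    subst id (sym (WinsPlay-cong (next a) (splice-≃ e s i (λ a → winnerI (next a) (a ∷ e)) a)
                                 (≃-refl {τ})))
      (select-spec idle (λ σ → ∀ τ → WinsPlay (next a) σ τ (a ∷ e)) win τ)

  followII-wins : ∀ next e t i a → IIWinsFrom (next a) (a ∷ e) →
    ∀ σ → ¬ WinsPlay (next a) σ (followII next e t i) (a ∷ e)
  followII-wins next e t i a win σ =
    select-spec idle (λ τ → ∀ σ → ¬ WinsPlay (next a) σ τ (a ∷ e)) win σ
    ∘ subst id (WinsPlay-cong (next a) (≃-refl {σ})
                              (splice-≃ e t i (λ a → winnerII (next a) (a ∷ e)) a))

  continuation : (ℕ → SimpleClopen) → Event → SimpleClopen
  continuation Gs (choice i) = Gs i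
  continuation Gs (block _) = Gs 0  -- never reached: only choice events follow a choice position

  module _ (G : SimpleClopen) {e r} (eq : stage G ∸ nBlocks e ≡ suc r) where

    IWinsFrom-block : (s : Strat) → (∀ t → IWinsFrom G (block (play s t) ∷ e)) → IWinsFrom G e
    IWinsFrom-block s win = σ , λ τ →
      subst id (sym (WinsPlay-block G {σ} {τ} eq (followI-move (λ _ → G) e s 0) refl))
        (followI-wins (λ _ → G) e s 0 _ (win (move τ e)) τ)
      where σ = followI (λ _ → G) e s 0

    IWinsFrom-block⁻ : IWinsFrom G e →
      Σ Strat λ s → ∀ t → IWinsFrom G (block (play s t) ∷ e)
    IWinsFrom-block⁻ (σ , win) = move σ e , λ t → σ , λ τ →
      let τ′ = splice e t 0 (λ _ → τ) in
      subst id (WinsPlay-cong G (≃-refl {σ}) (splice-≃ e t 0 (λ _ → τ) _))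
        (subst id (WinsPlay-block G {σ} {τ′} eq refl (move-splice e t 0 (λ _ → τ))) (win τ′))

    IIWinsFrom-block : (t : Strat) →
      (∀ s → IIWinsFrom G (block (play s t) ∷ e)) → IIWinsFrom G e
    IIWinsFrom-block t win = τ , λ σ →
      followII-wins (λ _ → G) e t 0 _ (win (move σ e)) σ
      ∘ subst id (WinsPlay-block G {σ} {τ} eq refl (followII-move (λ _ → G) e t 0))
      where τ = followII (λ _ → G) e t 0

  module _ {n} (Gs : ℕ → SimpleClopen) {e} (eq : n ∸ nBlocks e ≡ 0) where

    IWinsFrom-choiceI : ∀ i → IWinsFrom (Gs i) (choice i ∷ e) → IWinsFrom (choiceI n Gs) e
    IWinsFrom-choiceI i win = σ , λ τ →
      subst id (sym (WinsPlay-choiceI {Gs = Gs} {σ} {τ} eq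
                       (followI-pick (continuation Gs) e (λ _ → 0) i)))
        (followI-wins (continuation Gs) e _ i (choice i) win τ)
      where σ = followI (continuation Gs) e (λ _ → 0) i

    IWinsFrom-choiceI⁻ : IWinsFrom (choiceI n Gs) e →
      Σ ℕ λ i → IWinsFrom (Gs i) (choice i ∷ e)
    IWinsFrom-choiceI⁻ (σ , win) =
      pick σ e , σ , λ τ → subst id (WinsPlay-choiceI {Gs = Gs} {σ} {τ} eq refl) (win τ)

    IIWinsFrom-choiceI : (∀ i → IIWinsFrom (Gs i) (choice i ∷ e)) → IIWinsFrom (choiceI n Gs) e
    IIWinsFrom-choiceI win = τ , λ σ →
      followII-wins (continuation Gs) e _ 0 (choice (pick σ e)) (win (pick σ e)) σ
      ∘ subst id (WinsPlay-choiceI {Gs = Gs} {σ} {τ} eq refl)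
      where τ = followII (continuation Gs) e (λ _ → 0) 0

    IIWinsFrom-choiceII : ∀ i → IIWinsFrom (Gs i) (choice i ∷ e) → IIWinsFrom (choiceII n Gs) e
    IIWinsFrom-choiceII i win = τ , λ σ →
      followII-wins (continuation Gs) e _ i (choice i) win σ
      ∘ subst id (WinsPlay-choiceII {Gs = Gs} {σ} {τ} eq
                    (followII-pick (continuation Gs) e (λ _ → 0) i))
      where τ = followII (continuation Gs) e (λ _ → 0) i

    IWinsFrom-choiceII : (∀ i → IWinsFrom (Gs i) (choice i ∷ e)) → IWinsFrom (choiceII n Gs) e
    IWinsFrom-choiceII win = σ , λ τ →
      subst id (sym (WinsPlay-choiceII {Gs = Gs} {σ} {τ} eq refl))
        (followI-wins (continuation Gs) e _ 0 (choice (pick τ e)) (win (pick τ e)) τ)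
      where σ = followI (continuation Gs) e (λ _ → 0) 0

    IWinsFrom-choiceII⁻ : IWinsFrom (choiceII n Gs) e → ∀ i → IWinsFrom (Gs i) (choice i ∷ e)
    IWinsFrom-choiceII⁻ (σ , win) i = σ , λ τ →
      let τ′ = splice e (λ _ → 0) i (λ _ → τ) in
      subst id (WinsPlay-cong (Gs i) (≃-refl {σ}) (splice-≃ e (λ _ → 0) i (λ _ → τ) _))
        (subst id (WinsPlay-choiceII {Gs = Gs} {σ} {τ′} eq (pick-splice e (λ _ → 0) i (λ _ → τ)))
                  (win τ′))

  -- Without function extensionality a pointwise equal block need not give the same position,
  -- hence the transport hypothesis.
  IWinsFrom-block⇔ : ∀ G {e r} → stage G ∸ nBlocks e ≡ suc r →
    (∀ {x y} → x ≗ y → IWinsFrom G (block x ∷ e) → IWinsFrom G (block y ∷ e)) →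
    (Σ Baire λ p → ¬ Σ Baire λ q →
       ¬ IWinsFrom G (block (play (asStrategy p) (asStrategy q)) ∷ e))
    ⇔ IWinsFrom G e
  IWinsFrom-block⇔ G eq resp = mk⇔
    (λ (p , ¬∃q) → IWinsFrom-block G eq (asStrategy p) λ t → ¬¬-elim λ ¬win →
      ¬∃q (code t , ¬win ∘ resp (play-cong (λ _ → refl) (asStrategy-code t))))
    (λ win → let (s , win′) = IWinsFrom-block⁻ G eq win in
      code s , λ (q , ¬win) →
        ¬win (resp (sym ∘ play-cong (asStrategy-code s) (λ _ → refl)) (win′ (asStrategy q))))

  IWinsFrom-choiceI⇔ : ∀ {n} Gs {e} → n ∸ nBlocks e ≡ 0 →
    (Σ ℕ λ i → IWinsFrom (Gs i) (choice i ∷ e)) ⇔ IWinsFrom (choiceI n Gs) e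
  IWinsFrom-choiceI⇔ Gs eq =
    mk⇔ (λ (i , win) → IWinsFrom-choiceI Gs eq i win) (IWinsFrom-choiceI⁻ Gs eq)

  IWinsFrom-choiceII⇔ : ∀ {n} Gs {e} → n ∸ nBlocks e ≡ 0 →
    (¬ Σ ℕ λ i → ¬ IWinsFrom (Gs i) (choice i ∷ e)) ⇔ IWinsFrom (choiceII n Gs) e
  IWinsFrom-choiceII⇔ Gs eq = mk⇔
    (λ ¬∃i → IWinsFrom-choiceII Gs eq λ i → ¬¬-elim λ ¬win → ¬∃i (i , ¬win))
    (λ win (i , ¬win) → ¬win (IWinsFrom-choiceII⁻ Gs eq win i))

-- σ-projectivity of winning positions and determinacy

module _ (det : SigmaProjGamesDetermined) where
  open Classical (excludedMiddle det)

  sigmaProj-IWinsFrom : ∀ G r {k} (E : Pt k → List Event) {c} →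
    ContinuousPositions E c → stage G ∸ c ≡ r →
    SigmaProj k (λ v → IWinsFrom G (E v))
  sigmaProj-IWinsFrom G (suc r) E {c} E-cont eq =
    ext (proj fzero (compl (proj fzero (compl (sigmaProj-preimage next playCoordinate-continuous)))))
        (λ v → IWinsFrom-block⇔ G (trans (cong (stage G ∸_) (proj₁ E-cont v)) eq) (pushed-resp-≗ v))
    where
    next : SigmaProj _ (λ u → IWinsFrom G (pushBlock E u))
    next = sigmaProj-IWinsFrom G r (pushBlock E) (pushBlock-continuous E E-cont)
             (m∸n≡1+r⇒m∸[1+n]≡r (stage G) c eq)
    pushed-resp-≗ : ∀ v {x y} → x ≗ y →
      IWinsFrom G (block x ∷ E v) → IWinsFrom G (block y ∷ E v)
    pushed-resp-≗ v {x} {y} x≗y =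
      sigmaProj-resp-≋ next {insertAt v fzero x} {insertAt v fzero y}
        λ { fzero → x≗y ; (fsuc _) _ → refl }
  sigmaProj-IWinsFrom (base n A A-clopen) zero E E-cont eq =
    ext (sigmaProj-preimage (open′ (proj₁ A-clopen)) (firstBlocks-continuous E E-cont n))
        (λ v → IWinsFrom-base⇔ A-clopen (E v) (trans (cong (n ∸_) (proj₁ E-cont v)) eq))
  sigmaProj-IWinsFrom (choiceI n Gs) zero E E-cont eq =
    ext (union λ i → sigmaProj-IWinsFrom (Gs i) _ (λ v → choice i ∷ E v) E-cont refl)
        (λ v → IWinsFrom-choiceI⇔ Gs (trans (cong (n ∸_) (proj₁ E-cont v)) eq))
  sigmaProj-IWinsFrom (choiceII n Gs) zero E E-cont eq =
    ext (compl (union λ i →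
           compl (sigmaProj-IWinsFrom (Gs i) _ (λ v → choice i ∷ E v) E-cont refl)))
        (λ v → IWinsFrom-choiceII⇔ Gs (trans (cong (n ∸_) (proj₁ E-cont v)) eq))

  determinedFrom : ∀ G r e → stage G ∸ nBlocks e ≡ r → IWinsFrom G e ⊎ IIWinsFrom G e
  determinedFrom G (suc r) e eq =
    fromBlockGame (det _ (sigmaProj-IWinsFrom G r (pushBlock (λ _ → e)) nextBlock-continuous eq′))
    where
    nextBlock-continuous = pushBlock-continuous (λ _ → e) (const-continuous e)
    eq′ = m∸n≡1+r⇒m∸[1+n]≡r (stage G) (nBlocks e) eq
    fromBlockGame : Determined (λ x → IWinsFrom G (block x ∷ e)) →
      IWinsFrom G e ⊎ IIWinsFrom G e
    fromBlockGame (inj₁ (s , win)) = inj₁ (IWinsFrom-block G eq s win)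
    fromBlockGame (inj₂ (t , ¬win)) =
      inj₂ (IIWinsFrom-block G eq t λ s → [ ⊥-elim ∘ ¬win s , id ]′ (determinedFrom G r _ eq′))
  determinedFrom (base n A A-clopen) zero e eq with excludedMiddle det (A (firstBlocks n e))
  ... | yes a = inj₁ (Equivalence.to (IWinsFrom-base⇔ A-clopen e eq) a)
  ... | no ¬a = inj₂ (IIWinsFrom-base A-clopen e eq ¬a)
  determinedFrom (choiceI n Gs) zero e eq
    with excludedMiddle det (Σ ℕ λ i → IWinsFrom (Gs i) (choice i ∷ e))
  ... | yes (i , win) = inj₁ (IWinsFrom-choiceI Gs eq i win)
  ... | no ∄i = inj₂ (IIWinsFrom-choiceI Gs eq λ i →
          [ (λ win → ⊥-elim (∄i (i , win))) , id ]′ (determinedFrom (Gs i) _ (choice i ∷ e) refl))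
  determinedFrom (choiceII n Gs) zero e eq
    with excludedMiddle det (Σ ℕ λ i → IIWinsFrom (Gs i) (choice i ∷ e))
  ... | yes (i , win) = inj₂ (IIWinsFrom-choiceII Gs eq i win)
  ... | no ∄i = inj₁ (IWinsFrom-choiceII Gs eq λ i →
          [ id , (λ win → ⊥-elim (∄i (i , win))) ]′ (determinedFrom (Gs i) _ (choice i ∷ e) refl))

proposition2p7 : SigmaProjGamesDetermined → (G : SimpleClopen) → DeterminedSC G
proposition2p7 det G = determinedFrom det G _ [] refl
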